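{- Let $S=(s_i)$ be a good orientable sequence of order $n$ with odd weight and period $m$. If $T\in D^{ -1}(S)$, then $\mathcal{E}(T)$ is a good orientable sequence of order $n+1$ with odd weight, and its period is $2m$ if $m$ is odd and $2m+1$ if $m$ is even.
   Context: A periodic binary sequence $S=(s_i)$ has period $m$ = least $m>0$ with $s_{i+m}=s_i$ for all $i$; its generating cycle $[s_0,\dots,s_{m-1}]$ determines it. $\mathbf{s}_k(i)=(s_i,\dots,s_{i+k-1})$; $0^k$, $1^k$ denote the tuples of $k$ zeros/ones. The weight is $w(S)=\sum_{i=0}^{m-1}s_i$. The reverse of $(u_0,\dots,u_{n-1})$ is $(u_{n-1},\dots,u_0)$, written $\mathbf{u}^R$. An orientable sequence of order $n$ is a periodic binary sequence of period $m$ such that $\mathbf{s}_n(i)=\mathbf{s}_n(j)$ implies $i\equiv j\pmod m$ and $\mathbf{s}_n(i)\ne\mathbf{s}_n(j)^R$ for all $i,j$. An orientable sequence of order $n$ is good if $0^{n-4}$ occurs exactly once in a period. The Lempel map: $D((t_i))=(t_i\oplus t_{i+1})$ ($\oplus$ = addition mod 2); $D^{ -1}(S)$ is the set of periodic binary sequences $T$ with $D(T)=S$. The extension map $\mathcal{E}$, applied to an orientable sequence $U$ of order $k$ and period $p$ containing exactly one occurrence of $1^{k-4}$ per period: if $w(U)$ is odd, $\mathcal{E}(U)=U$; if $w(U)$ is even, write its generating cycle as $[u_0,\dots,u_{p-1}]$ with $u_r=\dots=u_{r+k-5}=1$ (the unique run) and let $\mathcal{E}(U)$ have generating cycle $[u_0,\dots,u_{r-1},1,u_r,\dots,u_{p-1}]$,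 i.e. $1^{k-4}$ is replaced by $1^{k-3}$. -}

module Defs where

open import Data.Bool using (Bool; true; false; if_then_else_; _xor_)
open import Data.Nat using (ℕ; zero; suc; _+_; _*_; _∸_; _<_; _≤_; _%_; _<ᵇ_; _≡ᵇ_)
open import Data.List using (List; map; upTo)
open import Data.Nat.ListAction using (sum)
open import Data.Vec using (Vec; tabulate; reverse; replicate)
open import Data.Fin using (toℕ)
open import Data.Product using (Σ; _×_; ∃-syntax)
open import Relation.Binary.PropositionalEquality using (_≡_; _≢_)

Seq : Set
Seq = ℕ → Bool

HasPeriod : Seq → ℕ → Set
HasPeriod s m = (0 < m) × (∀ i → s (i + m) ≡ s i)

IsPeriod : Seq → ℕ → Set
IsPeriod s m = HasPeriod s m × (∀ m' → HasPeriod s m' → m ≤ m')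

window : Seq → (k : ℕ) → ℕ → Vec Bool k
window s k i = tabulate (λ j → s (i + toℕ j))

ModEq : ℕ → ℕ → ℕ → Set
ModEq m i j = ∃[ a ] ∃[ b ] (i + a * m ≡ j + b * m)

Orientable : ℕ → ℕ → Seq → Set
Orientable n m s =
  IsPeriod s m
  × (∀ i j → window s n i ≡ window s n j → ModEq m i j)
  × (∀ i j → window s n i ≢ reverse (window s n j))

OccursOnceAt : Seq → ℕ → (k : ℕ) → Bool → ℕ → Set
OccursOnceAt s m k b r =
  (r < m) × (window s k r ≡ replicate k b)
  × (∀ i → i < m → window s k i ≡ replicate k b → i ≡ r)

OccursOnce : Seq → ℕ → (k : ℕ) → Bool → Set
OccursOnce s m k b = ∃[ r ] OccursOnceAt s m k b r

Good : ℕ → ℕ → Seq → Set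
Good n m s = Orientable n m s × OccursOnce s m (n ∸ 4) false

bit : Bool → ℕ
bit true = 1
bit false = 0

weight : Seq → ℕ → ℕ
weight s m = sum (map (λ i → bit (s i)) (upTo m))

InvLempel : Seq → Seq → Set
InvLempel S T = (∃[ p ] HasPeriod T p) × (∀ i → (T i xor T (suc i)) ≡ S i)

-- The extension map, given the period p of U and the start r (0 ≤ r < p)
-- of the unique run 1^{k-4} in the generating cycle [u_0,...,u_{p-1}].
-- If w(U) is odd, E(U) = U; otherwise E(U) has generating cycle
-- [u_0,...,u_{r-1},1,u_r,...,u_{p-1}] (of length p+1).
extCycle : Seq → ℕ → ℕ → Bool
extCycle U r j = if j <ᵇ r then U j else (if j ≡ᵇ r then true else U (j ∸ 1))

Ext : Seq → ℕ → ℕ → Seq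
Ext U p r with weight U p % 2
... | 0 = λ i → extCycle U r (i % suc p)
... | _ = U

-- Since S has odd weight, every T with D(T) = S satisfies T(i + m) = ¬T(i): T has period 2m
-- and weight ≡ m (mod 2). A window of T of length n+1 determines the window of S of length n
-- below it, and the bit T(i) fixes i modulo 2m once i is known modulo m; so T is orientable of
-- order n+1, and the run 0^(n-4) of S lifts to exactly one run 1^(n-3) and one run 0^(n-3) of T.
-- If m is odd, E(T) = T. If m is even, E(T) lengthens that run of ones to 1^(n-2), which no window
-- of T contains. A window of E(T) either is a window of T or contains the whole long run, and
-- such windows are told apart by the offset of the run; one of them could only be the reverse of
-- another if the window b 0 1^(n-3) 0 c of T around the run were a palindrome.
module Submission where

open import Defs
open import Data.Bool using (Bool; true; false; not; _xor_)
  renaming (_≟_ to _≟ᵇ_)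
open import Data.Bool.Properties
  using (xor-assoc; xor-comm; xor-identityʳ; xor-same; true-xor; not-involutive;
         not-injective; not-distribʳ-xor; not-¬; ¬-not)
open import Data.Nat
  using (ℕ; zero; suc; pred; _+_; _*_; _∸_; _%_; _/_; _<_; _≤_; z≤n; s≤s; z<s; s<s;
         _<ᵇ_; _≡ᵇ_; _≤?_; _<?_; NonZero)
open import Data.Nat.Properties
open import Data.Nat.DivMod
open import Data.Nat.ListAction using (sum)
open import Data.List using (map; applyUpTo)
open import Data.Vec using (Vec; tabulate; reverse; replicate; _∷_; _∷ʳ_)
open import Data.Vec.Properties using (reverse-∷; ∷-injective)
open import Data.Fin using (toℕ)
open import Data.Product using (_×_; _,_; proj₁; proj₂; ∃-syntax)
open import Data.Sum using (_⊎_; inj₁; inj₂)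
open import Data.Empty using (⊥; ⊥-elim)
open import Relation.Nullary using (¬_; yes; no)
open import Relation.Nullary.Reflects using (Reflects; ofʸ; ofⁿ; fromEquivalence)
open import Relation.Binary.PropositionalEquality
open import Relation.Binary.Definitions using (tri<; tri≈; tri>)
open import Data.Nat.Tactic.RingSolver using (solve-∀)
open import Function using (_∘_; const)
open ≡-Reasoning

-- Windows

tabulateℕ : (L : ℕ) → (ℕ → Bool) → Vec Bool L
tabulateℕ L g = tabulate (g ∘ toℕ)

tabulateℕ-injective : ∀ L f g → tabulateℕ L f ≡ tabulateℕ L g → ∀ t → t < L → f t ≡ g t
tabulateℕ-injective (suc L) f g e zero    _           = proj₁ (∷-injective e)
tabulateℕ-injective (suc L) f g e (suc t) (s≤s t<L) =
  tabulateℕ-injective L (f ∘ suc) (g ∘ suc) (proj₂ (∷-injective e)) t t<L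

tabulateℕ-cong : ∀ L f g → (∀ t → t < L → f t ≡ g t) → tabulateℕ L f ≡ tabulateℕ L g
tabulateℕ-cong zero    f g f≗g = refl
tabulateℕ-cong (suc L) f g f≗g =
  cong₂ _∷_ (f≗g 0 z<s) (tabulateℕ-cong L (f ∘ suc) (g ∘ suc) (λ t t<L → f≗g (suc t) (s<s t<L)))

tabulateℕ-∷ʳ : ∀ L f → tabulateℕ (suc L) f ≡ tabulateℕ L f ∷ʳ f L
tabulateℕ-∷ʳ zero    f = refl
tabulateℕ-∷ʳ (suc L) f = cong (f 0 ∷_) (tabulateℕ-∷ʳ L (f ∘ suc))

reverse-tabulateℕ : ∀ L g → reverse (tabulateℕ L g) ≡ tabulateℕ L (λ t → g (L ∸ suc t))
reverse-tabulateℕ zero    g = refl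
reverse-tabulateℕ (suc L) g = begin
  reverse (g 0 ∷ tabulateℕ L (g ∘ suc))          ≡⟨ reverse-∷ (g 0) (tabulateℕ L (g ∘ suc)) ⟩
  reverse (tabulateℕ L (g ∘ suc)) ∷ʳ g 0          ≡⟨ cong (_∷ʳ g 0) (reverse-tabulateℕ L (λ t → g (suc t))) ⟩
  tabulateℕ L (λ t → g (suc (L ∸ suc t))) ∷ʳ g 0  ≡⟨ cong₂ _∷ʳ_ inner (cong g (sym (n∸n≡0 L))) ⟩
  tabulateℕ L g′ ∷ʳ g′ L                           ≡⟨ tabulateℕ-∷ʳ L g′ ⟨
  tabulateℕ (suc L) g′                             ∎
  where
  g′ : ℕ → Bool
  g′ t = g (suc L ∸ suc t)
  inner : tabulateℕ L (λ t → g (suc (L ∸ suc t))) ≡ tabulateℕ L g′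
  inner = tabulateℕ-cong L _ _ (λ t t<L → cong g (sym (+-∸-assoc 1 t<L)))

replicate-tabulateℕ : ∀ L b → replicate L b ≡ tabulateℕ L (λ _ → b)
replicate-tabulateℕ zero    b = refl
replicate-tabulateℕ (suc L) b = cong (b ∷_) (replicate-tabulateℕ L b)

SameWindow : Seq → ℕ → ℕ → ℕ → Set
SameWindow s L i j = ∀ t → t < L → s (i + t) ≡ s (j + t)

MirrorWindow : Seq → ℕ → ℕ → ℕ → Set
MirrorWindow s L i j = ∀ t → t < L → s (i + t) ≡ s (j + (L ∸ suc t))

RunAt : Seq → ℕ → Bool → ℕ → Set
RunAt s L b i = ∀ t → t < L → s (i + t) ≡ b

shift : ℕ → Seq → Seq
shift c s x = s (c + x)

window-≡⇒SameWindow : ∀ s L i j → window s L i ≡ window s L j → SameWindow s L i j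
window-≡⇒SameWindow s L i j = tabulateℕ-injective L _ _

SameWindow⇒window-≡ : ∀ s L i j → SameWindow s L i j → window s L i ≡ window s L j
SameWindow⇒window-≡ s L i j = tabulateℕ-cong L _ _

window-≡-reverse⇒MirrorWindow : ∀ s L i j →
  window s L i ≡ reverse (window s L j) → MirrorWindow s L i j
window-≡-reverse⇒MirrorWindow s L i j e =
  tabulateℕ-injective L _ _ (trans e (reverse-tabulateℕ L (λ t → s (j + t))))

MirrorWindow⇒window-≡-reverse : ∀ s L i j →
  MirrorWindow s L i j → window s L i ≡ reverse (window s L j)
MirrorWindow⇒window-≡-reverse s L i j e =
  trans (tabulateℕ-cong L _ _ e) (sym (reverse-tabulateℕ L (λ t → s (j + t))))

window-replicate⇒RunAt : ∀ s L b i → window s L i ≡ replicate L b → RunAt s L b i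
window-replicate⇒RunAt s L b i e = tabulateℕ-injective L _ _ (trans e (replicate-tabulateℕ L b))

RunAt⇒window-replicate : ∀ s L b i → RunAt s L b i → window s L i ≡ replicate L b
RunAt⇒window-replicate s L b i e = trans (tabulateℕ-cong L _ _ e) (sym (replicate-tabulateℕ L b))

occursOnceAt : ∀ s m K b r → r < m → RunAt s K b r →
  (∀ i → i < m → RunAt s K b i → i ≡ r) → OccursOnceAt s m K b r
occursOnceAt s m K b r r<m run unique =
  r<m , RunAt⇒window-replicate s K b r run , (λ i i<m w → unique i i<m (window-replicate⇒RunAt s K b i w))

RunAt-zero : ∀ s L b i → 0 < L → RunAt s L b i → s i ≡ b
RunAt-zero s L b i 0<L run = trans (cong s (sym (+-identityʳ i))) (run 0 0<L)

SameWindow-sym : ∀ s L i j → SameWindow s L i j → SameWindow s L j i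
SameWindow-sym s L i j e t t<L = sym (e t t<L)

MirrorWindow-sym : ∀ s L i j → MirrorWindow s L i j → MirrorWindow s L j i
MirrorWindow-sym s (suc L) i j e t (s≤s t≤L) =
  sym (trans (e (L ∸ t) (s≤s (m∸n≤m L t))) (cong (λ u → s (j + u)) L∸[L∸t]≡t))
  where
  L∸[L∸t]≡t : L ∸ (L ∸ t) ≡ t
  L∸[L∸t]≡t = m∸[m∸n]≡n t≤L

-- Parity

xor-cancelˡ : ∀ a b c → a xor b ≡ a xor c → b ≡ c
xor-cancelˡ false b c e = e
xor-cancelˡ true  b c e = not-injective e

xor-interchange : ∀ a b c d → (a xor b) xor (c xor d) ≡ (a xor c) xor (b xor d)
xor-interchange a b c d = begin
  (a xor b) xor (c xor d)  ≡⟨ xor-assoc a b (c xor d) ⟩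
  a xor (b xor (c xor d))  ≡⟨ cong (a xor_) (xor-assoc b c d) ⟨
  a xor ((b xor c) xor d)  ≡⟨ cong (λ u → a xor (u xor d)) (xor-comm b c) ⟩
  a xor ((c xor b) xor d)  ≡⟨ cong (a xor_) (xor-assoc c b d) ⟩
  a xor (c xor (b xor d))  ≡⟨ xor-assoc a c (b xor d) ⟨
  (a xor c) xor (b xor d)  ∎

parity : (ℕ → Bool) → ℕ → Bool
parity h zero    = false
parity h (suc n) = h 0 xor parity (h ∘ suc) n

bit-xor : ∀ a x W → bit x ≡ W % 2 → bit (a xor x) ≡ (bit a + W) % 2
bit-xor false x W e = e
bit-xor true  x W e = begin
  bit (not x)        ≡⟨ bit-not x ⟩
  (1 + bit x) % 2    ≡⟨ cong (λ w → (1 + w) % 2) e ⟩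
  (1 + W % 2) % 2    ≡⟨ %-distribˡ-+ 1 W 2 ⟨
  (1 + W) % 2        ∎
  where
  bit-not : ∀ x → bit (not x) ≡ (1 + bit x) % 2
  bit-not false = refl
  bit-not true  = refl

weight%2≡bit-parity : ∀ s n → weight s n % 2 ≡ bit (parity s n)
weight%2≡bit-parity s n = sym (bit-parity-applyUpTo (λ i → i) n)
  where
  bit-parity-applyUpTo : ∀ f n →
    bit (parity (s ∘ f) n) ≡ sum (map (λ i → bit (s i)) (applyUpTo f n)) % 2
  bit-parity-applyUpTo f zero    = refl
  bit-parity-applyUpTo f (suc n) = bit-xor (s (f 0)) _ _ (bit-parity-applyUpTo (f ∘ suc) n)

odd-weight⇒parity : ∀ s n → weight s n % 2 ≡ 1 → parity s n ≡ true
odd-weight⇒parity s n odd with parity s n | trans (sym (weight%2≡bit-parity s n)) odd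
... | true | _ = refl

parity⇒odd-weight : ∀ s n → parity s n ≡ true → weight s n % 2 ≡ 1
parity⇒odd-weight s n odd = trans (weight%2≡bit-parity s n) (cong bit odd)

parity-true : ∀ n → bit (parity (const true) n) ≡ n % 2
parity-true zero    = refl
parity-true (suc n) = bit-xor true _ n (parity-true n)

parity-cong : ∀ n f g → (∀ t → t < n → f t ≡ g t) → parity f n ≡ parity g n
parity-cong zero    f g f≗g = refl
parity-cong (suc n) f g f≗g =
  cong₂ _xor_ (f≗g 0 z<s) (parity-cong n (f ∘ suc) (g ∘ suc) (λ t t<n → f≗g (suc t) (s<s t<n)))

parity-+ : ∀ h a b → parity h (a + b) ≡ parity h a xor parity (shift a h) b
parity-+ h zero    b = refl
parity-+ h (suc a) b =
  trans (cong (h 0 xor_) (parity-+ (h ∘ suc) a b)) (sym (xor-assoc (h 0) _ _))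

parity-∷ʳ : ∀ h n → parity h (suc n) ≡ parity h n xor h n
parity-∷ʳ h n = begin
  parity h (suc n)                       ≡⟨ cong (parity h) (+-comm 1 n) ⟩
  parity h (n + 1)                       ≡⟨ parity-+ h n 1 ⟩
  parity h n xor (h (n + 0) xor false)   ≡⟨ cong (λ u → parity h n xor u) (xor-identityʳ _) ⟩
  parity h n xor h (n + 0)               ≡⟨ cong (λ u → parity h n xor h u) (+-identityʳ n) ⟩
  parity h n xor h n                     ∎

parity-xor : ∀ f g n → parity (λ t → f t xor g t) n ≡ parity f n xor parity g n
parity-xor f g zero    = refl
parity-xor f g (suc n) =
  trans (cong ((f 0 xor g 0) xor_) (parity-xor (f ∘ suc) (g ∘ suc) n))
        (xor-interchange (f 0) (g 0) _ _)

parity-false : ∀ h n → (∀ t → t < n → h t ≡ false) → parity h n ≡ false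
parity-false h zero    h≗0 = refl
parity-false h (suc n) h≗0 rewrite h≗0 0 z<s =
  parity-false (h ∘ suc) n (λ t t<n → h≗0 (suc t) (s<s t<n))

-- Periodic and antiperiodic sequences

Periodic : Seq → ℕ → Set
Periodic s N = ∀ i → s (i + N) ≡ s i

Antiperiodic : Seq → ℕ → Set
Antiperiodic s N = ∀ i → s (i + N) ≡ not (s i)

shift-periodic : ∀ s N c → Periodic s N → Periodic (shift c s) N
shift-periodic s N c per x = trans (cong s (sym (+-assoc c x N))) (per (c + x))

shift-antiperiodic : ∀ s m c → Antiperiodic s m → Antiperiodic (shift c s) m
shift-antiperiodic s m c anti x = trans (cong s (sym (+-assoc c x m))) (anti (c + x))

parity-rotate : ∀ s N → Periodic s N → ∀ i → parity (shift i s) N ≡ parity s N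
parity-rotate s N per zero    = refl
parity-rotate s N per (suc i) = begin
  parity (shift (suc i) s) N      ≡⟨ parity-cong N _ _ (λ t _ → cong s (sym (+-suc i t))) ⟩
  parity (h ∘ suc) N              ≡⟨ xor-cancelˡ (h 0) _ _ wrap ⟩
  parity h N                      ≡⟨ parity-rotate s N per i ⟩
  parity s N                      ∎
  where
  h : ℕ → Bool
  h = shift i s
  wrap : h 0 xor parity (h ∘ suc) N ≡ h 0 xor parity h N
  wrap = begin
    parity h (suc N)     ≡⟨ parity-∷ʳ h N ⟩
    parity h N xor h N   ≡⟨ cong (parity h N xor_) (trans (per i) (cong s (sym (+-identityʳ i)))) ⟩
    parity h N xor h 0   ≡⟨ xor-comm (parity h N) (h 0) ⟩
    h 0 xor parity h N   ∎

parity-antiperiodic : ∀ h m → Antiperiodic h m → parity h (2 * m) ≡ parity (const true) m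
parity-antiperiodic h m anti = begin
  parity h (m + (m + 0))                              ≡⟨ cong (λ u → parity h (m + u)) (+-identityʳ m) ⟩
  parity h (m + m)                                    ≡⟨ parity-+ h m m ⟩
  parity h m xor parity (shift m h) m                 ≡⟨ cong (parity h m xor_) second-half ⟩
  parity h m xor (parity h m xor parity 1s m)         ≡⟨ xor-assoc (parity h m) _ _ ⟨
  (parity h m xor parity h m) xor parity 1s m         ≡⟨ cong (_xor parity 1s m) (xor-same (parity h m)) ⟩
  parity 1s m                                         ∎
  where
  1s : ℕ → Bool
  1s = const true
  second-half : parity (shift m h) m ≡ parity h m xor parity 1s m
  second-half = begin
    parity (shift m h) m            ≡⟨ parity-cong m _ _ (λ t _ → trans (cong h (+-comm m t)) (anti t)) ⟩
    parity (λ t → not (h t)) m      ≡⟨ parity-cong m _ _ (λ t _ → trans (sym (true-xor (h t))) (xor-comm true (h t))) ⟩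
    parity (λ t → h t xor true) m   ≡⟨ parity-xor h 1s m ⟩
    parity h m xor parity 1s m      ∎

antiperiodic-periodic : ∀ s m → Antiperiodic s m → Periodic s (2 * m)
antiperiodic-periodic s m anti i = begin
  s (i + (m + (m + 0)))  ≡⟨ cong (λ u → s (i + (m + u))) (+-identityʳ m) ⟩
  s (i + (m + m))        ≡⟨ cong s (+-assoc i m m) ⟨
  s (i + m + m)          ≡⟨ anti (i + m) ⟩
  not (s (i + m))        ≡⟨ cong not (anti i) ⟩
  not (not (s i))        ≡⟨ not-involutive (s i) ⟩
  s i                    ∎

antiperiodic-* : ∀ s m → Antiperiodic s m → ∀ i a → s (i + a * m) ≡ s i xor parity (const true) a
antiperiodic-* s m anti i zero    = trans (cong s (+-identityʳ i)) (sym (xor-identityʳ (s i)))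
antiperiodic-* s m anti i (suc a) = begin
  s (i + (m + a * m))                            ≡⟨ cong s (shuffle i m (a * m)) ⟩
  s (i + a * m + m)                              ≡⟨ anti (i + a * m) ⟩
  not (s (i + a * m))                            ≡⟨ cong not (antiperiodic-* s m anti i a) ⟩
  not (s i xor parity (const true) a)            ≡⟨ not-distribʳ-xor (s i) _ ⟩
  s i xor parity (const true) (suc a)            ∎
  where
  shuffle : ∀ i m x → i + (m + x) ≡ i + x + m
  shuffle = solve-∀

RunAt-antiperiodic : ∀ s m K b x → Antiperiodic s m → RunAt s K b x → RunAt s K (not b) (x + m)
RunAt-antiperiodic s m K b x anti run t t<K =
  trans (cong s (shuffle x m t)) (trans (anti (x + t)) (cong not (run t t<K)))
  where
  shuffle : ∀ x m t → x + m + t ≡ x + t + m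
  shuffle = solve-∀

RunAt-antiperiodic⁻ : ∀ s m K b y → Antiperiodic s m → RunAt s K b (m + y) → RunAt s K (not b) y
RunAt-antiperiodic⁻ s m K b y anti run t t<K =
  trans (sym (not-involutive (s (y + t))))
    (cong not (trans (sym (anti (y + t))) (trans (cong s (shuffle m y t)) (run t t<K))))
  where
  shuffle : ∀ m y t → y + t + m ≡ m + y + t
  shuffle = solve-∀

-- Residues

ModEq⇒%≡ : ∀ N .{{_ : NonZero N}} {i j} → ModEq N i j → i % N ≡ j % N
ModEq⇒%≡ N {i} {j} (a , b , e) = begin
  i % N            ≡⟨ [m+kn]%n≡m%n i a N ⟨
  (i + a * N) % N  ≡⟨ cong (_% N) e ⟩
  (j + b * N) % N  ≡⟨ [m+kn]%n≡m%n j b N ⟩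
  j % N            ∎

%≡⇒ModEq : ∀ N .{{_ : NonZero N}} {i j} → i % N ≡ j % N → ModEq N i j
%≡⇒ModEq N {i} {j} e = j / N , i / N , (begin
  i + j / N * N                  ≡⟨ cong (_+ j / N * N) (m≡m%n+[m/n]*n i N) ⟩
  i % N + i / N * N + j / N * N  ≡⟨ cong (λ x → x + i / N * N + j / N * N) e ⟩
  j % N + i / N * N + j / N * N  ≡⟨ swap (j % N) (i / N * N) (j / N * N) ⟩
  j % N + j / N * N + i / N * N  ≡⟨ cong (_+ i / N * N) (m≡m%n+[m/n]*n j N) ⟨
  j + i / N * N                  ∎)
  where
  swap : ∀ x a b → x + a + b ≡ x + b + a
  swap = solve-∀

ModEq-% : ∀ N .{{_ : NonZero N}} {i j} → ModEq N (i % N) (j % N) → ModEq N i j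
ModEq-% N {i} {j} e =
  %≡⇒ModEq N (trans (sym (m%n%n≡m%n i N)) (trans (ModEq⇒%≡ N e) (m%n%n≡m%n j N)))

ModEq-<⇒≡ : ∀ N .{{_ : NonZero N}} {i j} → i < N → j < N → ModEq N i j → i ≡ j
ModEq-<⇒≡ N {i} {j} i<N j<N e =
  trans (sym (m<n⇒m%n≡m i<N)) (trans (ModEq⇒%≡ N e) (m<n⇒m%n≡m j<N))

ModEq-cancelʳ : ∀ N i j c → ModEq N (i + c) (j + c) → ModEq N i j
ModEq-cancelʳ N i j c (a , b , e) =
  a , b , +-cancelʳ-≡ c _ _ (trans (swap i c (a * N)) (trans e (sym (swap j c (b * N)))))
  where
  swap : ∀ x c y → x + y + c ≡ x + c + y
  swap = solve-∀

ModEq-cancelˡ : ∀ N i j c → ModEq N (c + i) (c + j) → ModEq N i j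
ModEq-cancelˡ N i j c e = ModEq-cancelʳ N i j c (subst₂ (ModEq N) (+-comm c i) (+-comm c j) e)

antiperiodic-ModEq : ∀ s m → Antiperiodic s m → ∀ i j → s i ≡ s j → ModEq m i j → ModEq (2 * m) i j
antiperiodic-ModEq s m anti i j si≡sj (a , b , e) =
  a / 2 , b / 2 , +-cancelʳ-≡ (a % 2 * m) _ _ (begin
    i + a / 2 * (2 * m) + a % 2 * m   ≡⟨ regroup i (a % 2) (a / 2) m ⟩
    i + (a % 2 + a / 2 * 2) * m       ≡⟨ cong (λ x → i + x * m) (m≡m%n+[m/n]*n a 2) ⟨
    i + a * m                         ≡⟨ e ⟩
    j + b * m                         ≡⟨ cong (λ x → j + x * m) (m≡m%n+[m/n]*n b 2) ⟩
    j + (b % 2 + b / 2 * 2) * m       ≡⟨ cong (λ x → j + (x + b / 2 * 2) * m) (sym a%2≡b%2) ⟩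
    j + (a % 2 + b / 2 * 2) * m       ≡⟨ regroup j (a % 2) (b / 2) m ⟨
    j + b / 2 * (2 * m) + a % 2 * m   ∎)
  where
  regroup : ∀ i x y m → i + y * (2 * m) + x * m ≡ i + (x + y * 2) * m
  regroup = solve-∀
  parity-a≡parity-b : parity (const true) a ≡ parity (const true) b
  parity-a≡parity-b = xor-cancelˡ (s i) _ _ (begin
    s i xor parity (const true) a  ≡⟨ antiperiodic-* s m anti i a ⟨
    s (i + a * m)                  ≡⟨ cong s e ⟩
    s (j + b * m)                  ≡⟨ antiperiodic-* s m anti j b ⟩
    s j xor parity (const true) b  ≡⟨ cong (_xor parity (const true) b) si≡sj ⟨
    s i xor parity (const true) b  ∎)
  a%2≡b%2 : a % 2 ≡ b % 2
  a%2≡b%2 = trans (sym (parity-true a)) (trans (cong bit parity-a≡parity-b) (parity-true b))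

periodic-* : ∀ s N → Periodic s N → ∀ x a → s (x + a * N) ≡ s x
periodic-* s N per x zero    = cong s (+-identityʳ x)
periodic-* s N per x (suc a) =
  trans (cong s (shuffle x N (a * N))) (trans (per (x + a * N)) (periodic-* s N per x a))
  where
  shuffle : ∀ x N y → x + (N + y) ≡ x + y + N
  shuffle = solve-∀

periodic-% : ∀ s N .{{_ : NonZero N}} → Periodic s N → ∀ x t → s (x % N + t) ≡ s (x + t)
periodic-% s N per x t = begin
  s (x % N + t)                ≡⟨ periodic-* s N per (x % N + t) (x / N) ⟨
  s (x % N + t + x / N * N)    ≡⟨ cong s (shuffle (x % N) t (x / N * N)) ⟩
  s (x % N + x / N * N + t)    ≡⟨ cong (λ y → s (y + t)) (m≡m%n+[m/n]*n x N) ⟨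
  s (x + t)                    ∎
  where
  shuffle : ∀ a t b → a + t + b ≡ a + b + t
  shuffle = solve-∀

SameWindow-% : ∀ s N .{{_ : NonZero N}} L i j → Periodic s N →
  SameWindow s L i j → SameWindow s L (i % N) (j % N)
SameWindow-% s N L i j per e t t<L =
  trans (periodic-% s N per i t) (trans (e t t<L) (sym (periodic-% s N per j t)))

MirrorWindow-% : ∀ s N .{{_ : NonZero N}} L i j → Periodic s N →
  MirrorWindow s L i j → MirrorWindow s L (i % N) (j % N)
MirrorWindow-% s N L i j per e t t<L =
  trans (periodic-% s N per i t) (trans (e t t<L) (sym (periodic-% s N per j _)))

RunAt-% : ∀ s N .{{_ : NonZero N}} L b i → Periodic s N → RunAt s L b i → RunAt s L b (i % N)
RunAt-% s N L b i per run t t<L = trans (periodic-% s N per i t) (run t t<L)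

[z+q]%N≢z : ∀ N .{{_ : NonZero N}} z q → z < N → 0 < q → q < N → (z + q) % N ≢ z
[z+q]%N≢z N z q z<N 0<q q<N e = <⇒≢ 0<q (sym q≡0)
  where
  q≡0 : q ≡ 0
  q≡0 = ModEq-<⇒≡ N q<N (≤-<-trans z≤n q<N) (ModEq-cancelˡ N q 0 z (%≡⇒ModEq N [z+q]%N≡[z+0]%N))
    where
    [z+q]%N≡[z+0]%N : (z + q) % N ≡ (z + 0) % N
    [z+q]%N≡[z+0]%N = trans e (sym (trans (cong (_% N) (+-identityʳ z)) (m<n⇒m%n≡m z<N)))

OccursOnceAt⇒IsPeriod : ∀ s P K b z → Periodic s (suc P) → OccursOnceAt s (suc P) K b z → IsPeriod s (suc P)
OccursOnceAt⇒IsPeriod s P K b z per (z<N , run-z , unique) = (z<s , per) , least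
  where
  N = suc P
  least : ∀ q → HasPeriod s q → N ≤ q
  least q (0<q , per-q) with N ≤? q
  ... | yes N≤q = N≤q
  ... | no  N≰q = ⊥-elim ([z+q]%N≢z N z q z<N 0<q (≰⇒> N≰q) (unique _ (m%n<n (z + q) N) run-z+q))
    where
    shuffle : ∀ z q t → z + q + t ≡ z + t + q
    shuffle = solve-∀
    run-z+q : window s K ((z + q) % N) ≡ replicate K b
    run-z+q = RunAt⇒window-replicate s K b _ (RunAt-% s N K b (z + q) per (λ t t<K →
      trans (cong s (shuffle z q t)) (trans (per-q (z + t)) (window-replicate⇒RunAt s K b z run-z t t<K))))

-- Orientability under shifts

OrientableWindows : ℕ → ℕ → Seq → Set
OrientableWindows L N s =
  (∀ i j → SameWindow s L i j → ModEq N i j) × (∀ i j → ¬ MirrorWindow s L i j)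

Orientable⇒OrientableWindows : ∀ L N s → Orientable L N s → OrientableWindows L N s
Orientable⇒OrientableWindows L N s (_ , same , mirror) =
  (λ i j e → same i j (SameWindow⇒window-≡ s L i j e)) ,
  (λ i j e → mirror i j (MirrorWindow⇒window-≡-reverse s L i j e))

OrientableWindows⇒Orientable : ∀ L N s → IsPeriod s N → OrientableWindows L N s → Orientable L N s
OrientableWindows⇒Orientable L N s period (same , mirror) =
  period ,
  (λ i j e → same i j (window-≡⇒SameWindow s L i j e)) ,
  (λ i j e → mirror i j (window-≡-reverse⇒MirrorWindow s L i j e))

OrientableWindows-≗ : ∀ L N f g → (∀ x → f x ≡ g x) → OrientableWindows L N f → OrientableWindows L N g
OrientableWindows-≗ L N f g f≗g (same , mirror) =
  (λ i j e → same i j (λ t t<L → trans (f≗g _) (trans (e t t<L) (sym (f≗g _))))) ,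
  (λ i j e → mirror i j (λ t t<L → trans (f≗g _) (trans (e t t<L) (sym (f≗g _)))))

OrientableWindows-shift : ∀ L N s c → OrientableWindows L N s → OrientableWindows L N (shift c s)
OrientableWindows-shift L N s c (same , mirror) =
  (λ i j e → ModEq-cancelˡ N i j c (same (c + i) (c + j) (λ t t<L →
     trans (shift-+ i t) (trans (e t t<L) (sym (shift-+ j t)))))) ,
  (λ i j e → mirror (c + i) (c + j) (λ t t<L → trans (shift-+ i t) (trans (e t t<L) (sym (shift-+ j _)))))
  where
  shift-+ : ∀ i t → s (c + i + t) ≡ shift c s (i + t)
  shift-+ i t = cong s (+-assoc c i t)

shift-inverse : ∀ s P c → Periodic s (suc P) → ∀ x → shift (c * P) (shift c s) x ≡ s x
shift-inverse s P c per x = trans (cong s (shuffle c P x)) (periodic-* s (suc P) per x c)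
  where
  shuffle : ∀ c P x → c + (c * P + x) ≡ x + c * suc P
  shuffle = solve-∀

OrientableWindows-unshift : ∀ L P s c → Periodic s (suc P) →
  OrientableWindows L (suc P) (shift c s) → OrientableWindows L (suc P) s
OrientableWindows-unshift L P s c per ow =
  OrientableWindows-≗ L (suc P) _ s (shift-inverse s P c per)
    (OrientableWindows-shift L (suc P) (shift c s) (c * P) ow)

[m+n%d]%d≡[m+n]%d : ∀ m n d .{{_ : NonZero d}} → (m + n % d) % d ≡ (m + n) % d
[m+n%d]%d≡[m+n]%d m n d = begin
  (m + n % d) % d          ≡⟨ %-distribˡ-+ m (n % d) d ⟩
  (m % d + n % d % d) % d  ≡⟨ cong (λ x → (m % d + x) % d) (m%n%n≡m%n n d) ⟩
  (m % d + n % d) % d      ≡⟨ %-distribˡ-+ m n d ⟨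
  (m + n) % d              ∎

RunAt-shift⁻ : ∀ s P c K b i → Periodic s (suc P) → RunAt s K b i → RunAt (shift c s) K b (i + c * P)
RunAt-shift⁻ s P c K b i per run t t<K =
  trans (cong s (shuffle c i P t)) (trans (periodic-* s (suc P) per (i + t) c) (run t t<K))
  where
  shuffle : ∀ c i P t → c + (i + c * P + t) ≡ i + t + c * suc P
  shuffle = solve-∀

OccursOnceAt-unshift : ∀ s P c K b z → Periodic s (suc P) →
  OccursOnceAt (shift c s) (suc P) K b z → OccursOnceAt s (suc P) K b ((c + z) % suc P)
OccursOnceAt-unshift s P c K b z per (z<N , run-z , unique) =
  occursOnceAt s N K b _ (m%n<n (c + z) N) run unique′
  where
  N = suc P
  run : RunAt s K b ((c + z) % N)
  run t t<K = trans (periodic-% s N per (c + z) t)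
                (trans (cong s (+-assoc c z t)) (window-replicate⇒RunAt (shift c s) K b z run-z t t<K))
  unique′ : ∀ i → i < N → RunAt s K b i → i ≡ (c + z) % N
  unique′ i i<N run-i = begin
    i                          ≡⟨ m<n⇒m%n≡m i<N ⟨
    i % N                      ≡⟨ [m+kn]%n≡m%n i c N ⟨
    (i + c * N) % N            ≡⟨ cong (_% N) (shuffle c i P) ⟩
    (c + (i + c * P)) % N      ≡⟨ [m+n%d]%d≡[m+n]%d c (i + c * P) N ⟨
    (c + (i + c * P) % N) % N  ≡⟨ cong (λ y → (c + y) % N) j≡z ⟩
    (c + z) % N                ∎
    where
    shuffle : ∀ c i P → i + c * suc P ≡ c + (i + c * P)
    shuffle = solve-∀
    j≡z : (i + c * P) % N ≡ z
    j≡z = unique _ (m%n<n (i + c * P) N) (RunAt⇒window-replicate (shift c s) K b _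
            (RunAt-% (shift c s) N K b _ (shift-periodic s N c per) (RunAt-shift⁻ s P c K b i per run-i)))

OccursOnceAt-shift-unique : ∀ s P K b r → Periodic s (suc P) → OccursOnceAt s (suc P) K b r →
  ∀ x → x < suc P → RunAt (shift r s) K b x → x ≡ 0
OccursOnceAt-shift-unique s P K b r per occ zero    _   _   = refl
OccursOnceAt-shift-unique s P K b r per (r<N , _ , unique) (suc x) x<N run =
  ⊥-elim ([z+q]%N≢z N r (suc x) r<N z<s x<N (unique _ (m%n<n (r + suc x) N)
    (RunAt⇒window-replicate s K b _ (RunAt-% s N K b (r + suc x) per
      (λ t t<K → trans (cong s (+-assoc r (suc x) t)) (run t t<K))))))
  where N = suc P

-- The empty word occurs at every position, so occurring only once forces period 1,
-- and a constant sequence is its own reverse.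
Orientable⇒¬OccursOnce-empty : ∀ n m S → Orientable n m S → ¬ OccursOnce S m 0 false
Orientable⇒¬OccursOnce-empty n zero S (((() , _) , _) , _) _
Orientable⇒¬OccursOnce-empty n (suc zero) S (((_ , S-periodic) , _) , _ , mirror) _ =
  mirror 0 0 (MirrorWindow⇒window-≡-reverse S n 0 0 (λ t _ → trans (constant t) (sym (constant _))))
  where
  constant : ∀ t → S t ≡ S 0
  constant zero    = refl
  constant (suc t) = trans (cong S (+-comm 1 t)) (trans (S-periodic t) (constant t))
Orientable⇒¬OccursOnce-empty n (suc (suc m)) S _ (r , _ , _ , unique) =
  1+n≢0 (sym (trans (unique 0 z<s refl) (sym (unique 1 (s<s z<s) refl))))

-- The Lempel preimage

module Derivative (S T : Seq) (derivative : ∀ i → (T i xor T (suc i)) ≡ S i) where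

  T-suc : ∀ i → T (suc i) ≡ T i xor S i
  T-suc i with T i | derivative i
  ... | false | e = e
  ... | true  | e = trans (sym (not-involutive _)) (cong not e)

  T-+ : ∀ i j → T (i + j) ≡ T i xor parity (shift i S) j
  T-+ i zero    = trans (cong T (+-identityʳ i)) (sym (xor-identityʳ (T i)))
  T-+ i (suc j) = begin
    T (i + suc j)                                     ≡⟨ cong T (+-suc i j) ⟩
    T (suc i + j)                                     ≡⟨ T-+ (suc i) j ⟩
    T (suc i) xor parity (shift (suc i) S) j          ≡⟨ cong₂ _xor_ (T-suc i) (parity-cong j _ _ (λ t _ → cong S (sym (+-suc i t)))) ⟩
    (T i xor S i) xor parity (shift i S ∘ suc) j      ≡⟨ xor-assoc (T i) (S i) _ ⟩
    T i xor (S i xor parity (shift i S ∘ suc) j)      ≡⟨ cong (λ u → T i xor (S u xor parity (shift i S ∘ suc) j)) (+-identityʳ i) ⟨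
    T i xor parity (shift i S) (suc j)                ∎

  S≡T-xor : ∀ i t → S (i + t) ≡ T (i + t) xor T (i + suc t)
  S≡T-xor i t = sym (trans (cong (λ u → T (i + t) xor T u) (+-suc i t)) (derivative (i + t)))

  SameWindow-derivative : ∀ L i j → SameWindow T (suc L) i j → SameWindow S L i j
  SameWindow-derivative L i j e t t<L = begin
    S (i + t)                          ≡⟨ S≡T-xor i t ⟩
    T (i + t) xor T (i + suc t)        ≡⟨ cong₂ _xor_ (e t (m<n⇒m<1+n t<L)) (e (suc t) (s<s t<L)) ⟩
    T (j + t) xor T (j + suc t)        ≡⟨ S≡T-xor j t ⟨
    S (j + t)                          ∎

  MirrorWindow-derivative : ∀ L i j → MirrorWindow T (suc L) i j → MirrorWindow S L i j
  MirrorWindow-derivative L i j e t t<L = begin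
    S (i + t)                                         ≡⟨ S≡T-xor i t ⟩
    T (i + t) xor T (i + suc t)                       ≡⟨ cong₂ _xor_ (trans (e t (m<n⇒m<1+n t<L)) (cong (λ u → T (j + u)) mirror-index))
                                                                     (e (suc t) (s<s t<L)) ⟩
    T (j + suc (L ∸ suc t)) xor T (j + (L ∸ suc t))  ≡⟨ xor-comm (T (j + suc (L ∸ suc t))) (T (j + (L ∸ suc t))) ⟩
    T (j + (L ∸ suc t)) xor T (j + suc (L ∸ suc t))  ≡⟨ S≡T-xor j (L ∸ suc t) ⟨
    S (j + (L ∸ suc t))                               ∎
    where
    mirror-index : suc L ∸ suc t ≡ suc (L ∸ suc t)
    mirror-index = +-∸-assoc 1 t<L

  RunAt-derivative : ∀ K b i → RunAt T (suc K) b i → RunAt S K false i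
  RunAt-derivative K b i run t t<K = begin
    S (i + t)                     ≡⟨ S≡T-xor i t ⟩
    T (i + t) xor T (i + suc t)   ≡⟨ cong₂ _xor_ (run t (m<n⇒m<1+n t<K)) (run (suc t) (s<s t<K)) ⟩
    b xor b                       ≡⟨ xor-same b ⟩
    false                         ∎

  RunAt-integral : ∀ K i → RunAt S K false i → RunAt T (suc K) (T i) i
  RunAt-integral K i run t t≤K = begin
    T (i + t)                       ≡⟨ T-+ i t ⟩
    T i xor parity (shift i S) t    ≡⟨ cong (T i xor_) (parity-false _ t (λ u u<t → run u (<-≤-trans u<t (≤-pred t≤K)))) ⟩
    T i xor false                   ≡⟨ xor-identityʳ (T i) ⟩
    T i                             ∎

module Lempel (m₁ : ℕ) (S T : Seq)
  (S-periodic : Periodic S (suc m₁))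
  (S-odd : parity S (suc m₁) ≡ true)
  (derivative : ∀ i → (T i xor T (suc i)) ≡ S i) where

  open Derivative S T derivative

  m p : ℕ
  m = suc m₁
  p = 2 * m

  p≡m+m : p ≡ m + m
  p≡m+m = cong (m +_) (+-identityʳ m)

  T-antiperiodic : Antiperiodic T m
  T-antiperiodic i = begin
    T (i + m)                      ≡⟨ T-+ i m ⟩
    T i xor parity (shift i S) m   ≡⟨ cong (T i xor_) (trans (parity-rotate S m S-periodic i) S-odd) ⟩
    T i xor true                   ≡⟨ xor-comm (T i) true ⟩
    not (T i)                      ∎

  T-periodic : Periodic T p
  T-periodic = antiperiodic-periodic T m T-antiperiodic

  weight-T : weight T p % 2 ≡ m % 2
  weight-T = begin
    weight T p % 2                  ≡⟨ weight%2≡bit-parity T p ⟩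
    bit (parity T p)                ≡⟨ cong bit (parity-antiperiodic T m T-antiperiodic) ⟩
    bit (parity (const true) m)     ≡⟨ parity-true m ⟩
    m % 2                           ∎

  T-orientableWindows : ∀ n → OrientableWindows n m S → OrientableWindows (suc n) p T
  T-orientableWindows n (same , mirror) =
    (λ i j e → antiperiodic-ModEq T m T-antiperiodic i j (first-bit e) (same i j (SameWindow-derivative n i j e))) ,
    (λ i j e → mirror i j (MirrorWindow-derivative n i j e))
    where
    first-bit : ∀ {i j} → SameWindow T (suc n) i j → T i ≡ T j
    first-bit {i} {j} e = trans (cong T (sym (+-identityʳ i))) (trans (e 0 z<s) (cong T (+-identityʳ j)))

  module Runs (K r₀ : ℕ) (S-run : OccursOnceAt S m K false r₀) where

    r₀<m : r₀ < m
    r₀<m = proj₁ S-run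

    S-run-unique : ∀ i → i < m → RunAt S K false i → i ≡ r₀
    S-run-unique i i<m run = proj₂ (proj₂ S-run) i i<m (RunAt⇒window-replicate S K false i run)

    r₀<p : r₀ < p
    r₀<p = <-≤-trans r₀<m (m≤m+n m (m + 0))

    r₀+m<p : r₀ + m < p
    r₀+m<p = subst (r₀ + m <_) (sym p≡m+m) (+-monoˡ-< m r₀<m)

    T-run-r₀ : RunAt T (suc K) (T r₀) r₀
    T-run-r₀ = RunAt-integral K r₀ (window-replicate⇒RunAt S K false r₀ (proj₁ (proj₂ S-run)))

    T-run-r₀+m : RunAt T (suc K) (not (T r₀)) (r₀ + m)
    T-run-r₀+m = RunAt-antiperiodic T m (suc K) (T r₀) r₀ T-antiperiodic T-run-r₀

    T-run-positions : ∀ b i → i < p → RunAt T (suc K) b i → i ≡ r₀ ⊎ i ≡ r₀ + m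
    T-run-positions b i i<p run with i <? m
    ... | yes i<m = inj₁ (S-run-unique i i<m (RunAt-derivative K b i run))
    ... | no  i≮m with m≤n⇒∃[o]m+o≡n (≮⇒≥ i≮m)
    ... | y , m+y≡i = inj₂ (begin
      i      ≡⟨ m+y≡i ⟨
      m + y  ≡⟨ cong (m +_) (S-run-unique y y<m (RunAt-derivative K (not b) y run-y)) ⟩
      m + r₀ ≡⟨ +-comm m r₀ ⟩
      r₀ + m ∎)
      where
      y<m : y < m
      y<m = +-cancelˡ-< m y m (subst₂ _<_ (sym m+y≡i) p≡m+m i<p)
      run-y : RunAt T (suc K) (not b) y
      run-y = RunAt-antiperiodic⁻ T m (suc K) b y T-antiperiodic (subst (RunAt T (suc K) b) (sym m+y≡i) run)

    T-occursOnce : ∀ b → ∃[ z ] OccursOnceAt T p (suc K) b z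
    T-occursOnce b with T r₀ ≟ᵇ b
    ... | yes T-r₀≡b = r₀ , occursOnceAt T p (suc K) b r₀ r₀<p run unique
      where
      run : RunAt T (suc K) b r₀
      run = subst (λ c → RunAt T (suc K) c r₀) T-r₀≡b T-run-r₀
      unique : ∀ i → i < p → RunAt T (suc K) b i → i ≡ r₀
      unique i i<p run with T-run-positions b i i<p run
      ... | inj₁ i≡r₀   = i≡r₀
      ... | inj₂ i≡r₀+m = ⊥-elim (not-¬ refl (trans T-r₀≡b (trans (sym (RunAt-zero T (suc K) b i z<s run))
                            (trans (cong T i≡r₀+m) (RunAt-zero T (suc K) _ (r₀ + m) z<s T-run-r₀+m)))))
    ... | no T-r₀≢b = r₀ + m , occursOnceAt T p (suc K) b (r₀ + m) r₀+m<p run unique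
      where
      run : RunAt T (suc K) b (r₀ + m)
      run = subst (λ c → RunAt T (suc K) c (r₀ + m)) (sym (¬-not (T-r₀≢b ∘ sym))) T-run-r₀+m
      unique : ∀ i → i < p → RunAt T (suc K) b i → i ≡ r₀ + m
      unique i i<p run with T-run-positions b i i<p run
      ... | inj₂ i≡r₀+m = i≡r₀+m
      ... | inj₁ i≡r₀   = ⊥-elim (T-r₀≢b (trans (sym (cong T i≡r₀)) (RunAt-zero T (suc K) b i z<s run)))

-- Inserting a bit next to the run of ones

module WindowShapes (k : ℕ) where

  L : ℕ
  L = 6 + k

  LongRunAt : (ℕ → Bool) → ℕ → Set
  LongRunAt f o = RunAt f (3 + k) true o × (∀ q → suc q ≡ o → f q ≡ false)

  -- f agrees with the window at offset o of the cyclic word b 0 1^(3+k) 0 c.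
  NewWindowShape : (ℕ → Bool) → ℕ → Bool → Bool → Set
  NewWindowShape f o b c =
    LongRunAt f o × (o ≤ 2 → f (o + (3 + k)) ≡ false) × (o ≤ 1 → f (o + (4 + k)) ≡ c)
    × (∀ q → 2 + q ≡ o → f q ≡ b)

  ≤5⇒<L : ∀ c → c ≤ 5 → c < L
  ≤5⇒<L c c≤5 = s≤s (≤-trans c≤5 (m≤m+n 5 k))

  LongRunAt-offset-< : ∀ f o o′ → o < o′ → o′ ≤ 3 → LongRunAt f o → ¬ LongRunAt f o′
  LongRunAt-offset-< f o (suc q) (s≤s o≤q) (s≤s q≤2) (run , _) (_ , preceded) =
    not-¬ refl (trans (sym (preceded q refl)) (trans (cong f (sym (m+[n∸m]≡n o≤q))) f-q))
    where
    f-q : f (o + (q ∸ o)) ≡ true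
    f-q = run (q ∸ o) (≤-<-trans (≤-trans (m∸n≤m q o) q≤2) (s≤s (s≤s (s≤s z≤n))))

  LongRunAt-offset-unique : ∀ f o o′ → o ≤ 3 → o′ ≤ 3 → LongRunAt f o → LongRunAt f o′ → o ≡ o′
  LongRunAt-offset-unique f o o′ o≤3 o′≤3 run run′ with <-cmp o o′
  ... | tri< o<o′ _ _ = ⊥-elim (LongRunAt-offset-< f o o′ o<o′ o′≤3 run run′)
  ... | tri≈ _ o≡o′ _ = o≡o′
  ... | tri> _ _ o>o′ = ⊥-elim (LongRunAt-offset-< f o′ o o>o′ o≤3 run′ run)

  LongRunAt-transfer : ∀ f g o → o ≤ 3 → (∀ t → t < L → f t ≡ g t) → LongRunAt g o → LongRunAt f o
  LongRunAt-transfer f g o o≤3 f≗g (run , preceded) =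
    (λ t t<K → trans (f≗g (o + t) (+-mono-≤-< o≤3 t<K)) (run t t<K)) ,
    (λ q q+1≡o → trans (f≗g q (q<L q q+1≡o)) (preceded q q+1≡o))
    where
    q<L : ∀ q → suc q ≡ o → q < L
    q<L q q+1≡o = ≤5⇒<L q (≤-trans (<⇒≤ (subst (_≤ 3) (sym q+1≡o) o≤3)) (s≤s (s≤s (s≤s z≤n))))

  NewWindowShape-b≡c : ∀ f o b c → NewWindowShape f o b c → NewWindowShape f o c b → b ≡ c
  NewWindowShape-b≡c f zero          b c (_ , _ , c-at , _) (_ , _ , b-at , _) = trans (sym (b-at z≤n)) (c-at z≤n)
  NewWindowShape-b≡c f (suc zero)    b c (_ , _ , c-at , _) (_ , _ , b-at , _) = trans (sym (b-at (s≤s z≤n))) (c-at (s≤s z≤n))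
  NewWindowShape-b≡c f (suc (suc q)) b c (_ , _ , _ , b-at) (_ , _ , _ , c-at) = trans (sym (b-at q refl)) (c-at q refl)

  NewWindowShape-reverse : ∀ f g o o′ b c → o + o′ ≡ 3 → (∀ t → t < L → f t ≡ g (5 + k ∸ t)) →
    NewWindowShape g o b c → NewWindowShape f o′ c b
  NewWindowShape-reverse f g zero .3 b c refl f≗g ((run , _) , zero-at , c-at , _) =
    ((λ t t<K → trans (f≗g (3 + t) (s≤s (s≤s (s≤s t<K)))) (run (2 + k ∸ t) (s≤s (m∸n≤m (2 + k) t)))) ,
     (λ { .2 refl → trans (f≗g 2 (≤5⇒<L 2 (s≤s (s≤s z≤n)))) (zero-at z≤n) })) ,
    (λ { (s≤s (s≤s ())) }) , (λ { (s≤s ()) }) ,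
    (λ { .1 refl → trans (f≗g 1 (≤5⇒<L 1 (s≤s z≤n))) (c-at z≤n) })
  NewWindowShape-reverse f g (suc zero) .2 b c refl f≗g ((run , preceded) , zero-at , c-at , _) =
    ((λ t t<K → trans (f≗g (2 + t) (+-mono-≤-< {2} {3} (s≤s (s≤s z≤n)) t<K))
                  (trans (cong g (+-∸-assoc 1 (≤-pred t<K))) (run (2 + k ∸ t) (s≤s (m∸n≤m (2 + k) t))))) ,
     (λ { .1 refl → trans (f≗g 1 (≤5⇒<L 1 (s≤s z≤n))) (zero-at (s≤s z≤n)) })) ,
    (λ _ → trans (f≗g (5 + k) (n<1+n _)) (trans (cong g (n∸n≡0 (5 + k))) (preceded 0 refl))) ,
    (λ { (s≤s ()) }) ,
    (λ { .0 refl → trans (f≗g 0 z<s) (c-at (s≤s z≤n)) })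
  NewWindowShape-reverse f g (suc (suc zero)) .1 b c refl f≗g ((run , preceded) , zero-at , _ , b-at) =
    ((λ t t<K → trans (f≗g (1 + t) (+-mono-≤-< {1} {3} (s≤s z≤n) t<K))
                  (trans (cong g (+-∸-assoc 2 (≤-pred t<K))) (run (2 + k ∸ t) (s≤s (m∸n≤m (2 + k) t))))) ,
     (λ { .0 refl → trans (f≗g 0 z<s) (zero-at (s≤s (s≤s z≤n))) })) ,
    (λ _ → trans (f≗g (4 + k) (m≤n⇒m≤1+n (n<1+n _))) (trans (cong g (m+n∸n≡m 1 (4 + k))) (preceded 1 refl))) ,
    (λ _ → trans (f≗g (5 + k) (n<1+n _)) (trans (cong g (n∸n≡0 (5 + k))) (b-at 0 refl))) ,
    (λ { q () })
  NewWindowShape-reverse f g (suc (suc (suc zero))) .0 b c refl f≗g ((run , preceded) , _ , _ , b-at) =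
    ((λ t t<K → trans (f≗g t (≤-trans t<K (m≤n+m (3 + k) 3)))
                  (trans (cong g (+-∸-assoc 3 (≤-pred t<K))) (run (2 + k ∸ t) (s≤s (m∸n≤m (2 + k) t))))) ,
     (λ { q () })) ,
    (λ _ → trans (f≗g (3 + k) (≤-trans (n<1+n (3 + k)) (m≤n+m (4 + k) 2))) (trans (cong g (m+n∸n≡m 2 (3 + k))) (preceded 2 refl))) ,
    (λ _ → trans (f≗g (4 + k) (m≤n⇒m≤1+n (n<1+n _))) (trans (cong g (m+n∸n≡m 1 (4 + k))) (b-at 1 refl))) ,
    (λ { q () })

module LengthenedRun (k m₁ : ℕ) (T V : Seq)
  (T-periodic : Periodic T (2 * suc m₁))
  (T-antiperiodic : Antiperiodic T (suc m₁))
  (T-run : RunAt T (2 + k) true 0)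
  (T-run-unique : ∀ x → x < 2 * suc m₁ → RunAt T (2 + k) true x → x ≡ 0)
  (T-orientable : OrientableWindows (6 + k) (2 * suc m₁) T)
  (V-0 : V 0 ≡ true)
  (V-suc : ∀ y → y < 2 * suc m₁ → V (suc y) ≡ T y)
  (V-periodic : Periodic V (suc (2 * suc m₁))) where

  open WindowShapes k

  m p N : ℕ
  m = suc m₁
  p = 2 * m
  N = suc p

  p≡m+m : p ≡ m + m
  p≡m+m = cong (m +_) (+-identityʳ m)

  m<p : m < p
  m<p = m<m+n m z<s

  run-fits : 2 + k ≤ m
  run-fits with 2 + k ≤? m
  ... | yes 2+k≤m = 2+k≤m
  ... | no  2+k≰m = ⊥-elim (not-¬ refl (trans (sym (T-run m (≰⇒> 2+k≰m)))
                      (trans (T-antiperiodic 0) (cong not (T-run 0 z<s)))))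

  2≤m : 2 ≤ m
  2≤m = ≤-trans (s≤s (s≤s z≤n)) run-fits

  1<p : 1 < p
  1<p = ≤-trans 2≤m (<⇒≤ m<p)

  2+k<p : 2 + k < p
  2+k<p = ≤-<-trans run-fits m<p

  3+k<p : 3 + k < p
  3+k<p = +-mono-≤ 2≤m (subst (2 + k ≤_) (sym (+-identityʳ m)) run-fits)

  T-after-run : T (2 + k) ≡ false
  T-after-run with T (2 + k) in T-2+k
  ... | false = refl
  ... | true  = ⊥-elim (1+n≢0 (T-run-unique 1 1<p run-1))
    where
    run-1 : RunAt T (2 + k) true 1
    run-1 t t<2+k with m≤n⇒m<n∨m≡n t<2+k
    ... | inj₁ t+1<2+k  = T-run (suc t) t+1<2+k
    ... | inj₂ t+1≡2+k = trans (cong T t+1≡2+k) T-2+k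

  T-before-run : T (p ∸ 1) ≡ false
  T-before-run with T (p ∸ 1) in T-p-1
  ... | false = refl
  ... | true  = ⊥-elim (<⇒≱ 1<p (m∸n≡0⇒m≤n (T-run-unique (p ∸ 1) (n<1+n _) run-p-1)))
    where
    run-p-1 : RunAt T (2 + k) true (p ∸ 1)
    run-p-1 zero    _         = trans (cong T (+-identityʳ _)) T-p-1
    run-p-1 (suc t) t+1<2+k = trans (cong T (+-suc (p ∸ 1) t)) (trans (cong T (+-comm p t))
                                (trans (T-periodic t) (T-run t (<-trans (n<1+n t) t+1<2+k))))

  T-no-long-run : ∀ y → y < p → ¬ RunAt T (3 + k) true y
  T-no-long-run y y<p run = 1+n≢0 (T-run-unique 1 1<p run-1)
    where
    y≡0 : y ≡ 0
    y≡0 = T-run-unique y y<p (λ t t<2+k → run t (m<n⇒m<1+n t<2+k))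
    run-1 : RunAt T (2 + k) true 1
    run-1 t t<2+k = trans (cong (λ z → T (z + suc t)) (sym y≡0)) (run (suc t) (s<s t<2+k))

  V-N+ : ∀ x → V (N + x) ≡ V x
  V-N+ x = trans (cong V (+-comm N x)) (V-periodic x)

  V-low : ∀ t → t < 3 + k → V t ≡ true
  V-low zero    _         = V-0
  V-low (suc y) (s≤s y<2+k) = trans (V-suc y (<-trans y<2+k 2+k<p)) (T-run y y<2+k)

  V-3+k : V (3 + k) ≡ false
  V-3+k = trans (V-suc (2 + k) 2+k<p) T-after-run

  V-p : V p ≡ false
  V-p = trans (V-suc (p ∸ 1) (n<1+n _)) T-before-run

  2+[p∸2]≡p : 2 + (p ∸ 2) ≡ p
  2+[p∸2]≡p = m+[n∸m]≡n (≤-trans 2≤m (<⇒≤ m<p))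

  p∸2<p : p ∸ 2 < p
  p∸2<p = subst (p ∸ 2 <_) 2+[p∸2]≡p (<-trans (n<1+n _) (n<1+n _))

  b c : Bool
  b = V (p ∸ 1)
  c = V (4 + k)

  -- Otherwise the window b 0 1^(2+k) 0 c of T at p ∸ 2 would be a palindrome.
  b≢c : b ≢ c
  b≢c b≡c = proj₂ T-orientable (p ∸ 2) (p ∸ 2) palindrome
    where
    u : ℕ → Bool
    u t = T (p ∸ 2 + t)
    u-2+ : ∀ s → u (2 + s) ≡ T s
    u-2+ s = trans (cong T (trans (shuffle (p ∸ 2) s) (cong (s +_) 2+[p∸2]≡p))) (T-periodic s)
      where
      shuffle : ∀ a s → a + (2 + s) ≡ s + (2 + a)
      shuffle = solve-∀
    u-1 : u 1 ≡ false
    u-1 = trans (cong T (trans (+-comm (p ∸ 2) 1) (cong pred 2+[p∸2]≡p))) T-before-run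
    u-4+k : u (4 + k) ≡ false
    u-4+k = trans (u-2+ (2 + k)) T-after-run
    u-0≡u-5+k : u 0 ≡ u (5 + k)
    u-0≡u-5+k = begin
      T (p ∸ 2 + 0)    ≡⟨ cong T (+-identityʳ (p ∸ 2)) ⟩
      T (p ∸ 2)        ≡⟨ V-suc (p ∸ 2) p∸2<p ⟨
      V (suc (p ∸ 2))  ≡⟨ cong (V ∘ pred) 2+[p∸2]≡p ⟩
      b                ≡⟨ b≡c ⟩
      c                ≡⟨ V-suc (3 + k) 3+k<p ⟩
      T (3 + k)        ≡⟨ u-2+ (3 + k) ⟨
      u (5 + k)        ∎
    palindrome : ∀ t → t < L → u t ≡ u (5 + k ∸ t)
    palindrome zero          _ = u-0≡u-5+k
    palindrome (suc zero)    _ = trans u-1 (sym u-4+k)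
    palindrome (suc (suc s)) (s≤s (s≤s s<4+k)) with <-cmp s (2 + k)
    ... | tri< s<2+k _ _ = begin
      u (2 + s)                  ≡⟨ trans (u-2+ s) (T-run s s<2+k) ⟩
      true                       ≡⟨ T-run (1 + k ∸ s) (s≤s (m∸n≤m (1 + k) s)) ⟨
      T (1 + k ∸ s)              ≡⟨ u-2+ (1 + k ∸ s) ⟨
      u (2 + (1 + k ∸ s))        ≡⟨ cong u (+-∸-assoc 2 (≤-pred s<2+k)) ⟨
      u (3 + k ∸ s)              ∎
    ... | tri≈ _ refl _ = trans u-4+k (sym (trans (cong u (m+n∸n≡m 1 (2 + k))) u-1))
    ... | tri> _ _ s>2+k rewrite ≤-antisym (≤-pred s<4+k) s>2+k =
      trans (sym u-0≡u-5+k) (cong u (sym (n∸n≡0 (3 + k))))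

  V-old-window : ∀ i → i + 4 ≤ p → ∀ t → t < L → V (suc i + t) ≡ T (i + t)
  V-old-window i i+4≤p t t<L with i + t <? p
  ... | yes i+t<p = V-suc (i + t) i+t<p
  ... | no  i+t≮p with m≤n⇒∃[o]m+o≡n (≮⇒≥ i+t≮p)
  ... | y , p+y≡i+t = begin
    V (suc (i + t))  ≡⟨ cong (V ∘ suc) p+y≡i+t ⟨
    V (N + y)        ≡⟨ V-N+ y ⟩
    V y              ≡⟨ V-low y (m<n⇒m<1+n y<2+k) ⟩
    true             ≡⟨ T-run y y<2+k ⟨
    T y              ≡⟨ T-periodic y ⟨
    T (y + p)        ≡⟨ cong T (trans (+-comm y p) p+y≡i+t) ⟩
    T (i + t)        ∎
    where
    shuffle : ∀ a b → a + 4 + b ≡ a + b + 4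
    shuffle = solve-∀
    y<2+k : y < 2 + k
    y<2+k = +-cancelʳ-< 4 y (2 + k) (+-cancelˡ-< p (y + 4) ((2 + k) + 4)
              (subst₂ _<_ (trans (shuffle i t) (trans (cong (_+ 4) (sym p+y≡i+t)) (+-assoc p y 4)))
                          (cong (p +_) (+-comm 4 (2 + k)))
                          (≤-<-trans (+-mono-≤ i+4≤p (≤-refl {t})) (+-monoʳ-< p t<L))))

  old-window-no-long-run : ∀ i → i + 4 ≤ p → ∀ o → o ≤ 3 → ¬ LongRunAt (shift (suc i) V) o
  old-window-no-long-run i i+4≤p o o≤3 (run , _) =
    T-no-long-run (i + o) (<-≤-trans (+-monoʳ-< i (s≤s o≤3)) i+4≤p) (λ t t<3+k →
      trans (cong T (+-assoc i o t))
            (trans (sym (V-old-window i i+4≤p (o + t) (+-mono-≤-< o≤3 t<3+k))) (run t t<3+k)))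

  V-new-window : ∀ x o → x + o ≡ N → NewWindowShape (shift x V) o b c
  V-new-window x o x+o≡N =
    ((λ t t<3+k → trans (cong V (x+o+ t)) (trans (V-N+ t) (V-low t t<3+k))) ,
     (λ q q+1≡o → trans (cong V (x+q≡p q q+1≡o)) V-p)) ,
    (λ _ → trans (cong V (x+o+ (3 + k))) (trans (V-N+ _) V-3+k)) ,
    (λ _ → trans (cong V (x+o+ (4 + k))) (V-N+ _)) ,
    (λ q q+2≡o → cong V (x+q≡p∸1 q q+2≡o))
    where
    x+o+ : ∀ t → x + (o + t) ≡ N + t
    x+o+ t = trans (sym (+-assoc x o t)) (cong (_+ t) x+o≡N)
    x+q≡p : ∀ q → suc q ≡ o → x + q ≡ p
    x+q≡p q q+1≡o = suc-injective (trans (sym (+-suc x q)) (trans (cong (x +_) q+1≡o) x+o≡N))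
    x+q≡p∸1 : ∀ q → 2 + q ≡ o → x + q ≡ p ∸ 1
    x+q≡p∸1 q q+2≡o = suc-injective (suc-injective
      (trans (sym (trans (+-suc x (suc q)) (cong suc (+-suc x q)))) (trans (cong (x +_) q+2≡o) x+o≡N)))

  V-new-window-0 : NewWindowShape (shift 0 V) 0 b c
  V-new-window-0 = (V-low , (λ _ ())) , (λ _ → V-3+k) , (λ _ → refl) , (λ _ ())

  -- The new windows are those containing the whole lengthened run 1^(3+k); every other window of V is one of T.
  data WindowKind : ℕ → Set where
    old : ∀ {i} → i + 4 ≤ p → WindowKind (suc i)
    new : ∀ {i} o → o ≤ 3 → NewWindowShape (shift i V) o b c → (i + o) % N ≡ 0 → WindowKind i

  windowKind : ∀ i → i < N → WindowKind i
  windowKind zero    _ = new 0 z≤n V-new-window-0 refl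
  windowKind (suc i) (s≤s i<p) with i + 4 ≤? p
  ... | yes i+4≤p = old i+4≤p
  ... | no  i+4≰p with m≤n⇒∃[o]m+o≡n (<⇒≤ i<p)
  ... | d , i+d≡p = new d d≤3 (V-new-window (suc i) d (cong suc i+d≡p))
                      (trans (cong (_% N) (cong suc i+d≡p)) (n%n≡0 N))
    where
    d≤3 : d ≤ 3
    d≤3 = ≤-pred (+-cancelˡ-< i d 4 (subst (_< i + 4) (sym i+d≡p) (≰⇒> i+4≰p)))

  new-position-unique : ∀ i j o → i < N → j < N → (i + o) % N ≡ 0 → (j + o) % N ≡ 0 → i ≡ j
  new-position-unique i j o i<N j<N i+o≡0 j+o≡0 =
    ModEq-<⇒≡ N i<N j<N (ModEq-cancelʳ N i j o (%≡⇒ModEq N (trans i+o≡0 (sym j+o≡0))))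

  old<p : ∀ i → i + 4 ≤ p → i < p
  old<p i i+4≤p = <-≤-trans (m<m+n i z<s) i+4≤p

  V-same-window : ∀ i j → i < N → j < N → SameWindow V L i j → i ≡ j
  V-same-window i j i<N j<N same with windowKind i i<N | windowKind j j<N
  ... | old {i′} i′+4≤p | old {j′} j′+4≤p =
    cong suc (ModEq-<⇒≡ p (old<p i′ i′+4≤p) (old<p j′ j′+4≤p) (proj₁ T-orientable i′ j′ (λ t t<L →
      trans (sym (V-old-window i′ i′+4≤p t t<L)) (trans (same t t<L) (V-old-window j′ j′+4≤p t t<L)))))
  ... | old {i′} i′+4≤p | new o o≤3 shape _ =
    ⊥-elim (old-window-no-long-run i′ i′+4≤p o o≤3 (LongRunAt-transfer _ (shift j V) o o≤3 same (proj₁ shape)))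
  ... | new o o≤3 shape _ | old {j′} j′+4≤p =
    ⊥-elim (old-window-no-long-run j′ j′+4≤p o o≤3
      (LongRunAt-transfer _ (shift i V) o o≤3 (SameWindow-sym V L i j same) (proj₁ shape)))
  ... | new o o≤3 shape pos | new o′ o′≤3 shape′ pos′ =
    new-position-unique i j o i<N j<N pos (subst (λ x → (j + x) % N ≡ 0) (sym o≡o′) pos′)
    where
    o≡o′ : o ≡ o′
    o≡o′ = LongRunAt-offset-unique (shift i V) o o′ o≤3 o′≤3 (proj₁ shape)
             (LongRunAt-transfer _ (shift j V) o′ o′≤3 same (proj₁ shape′))

  old-not-mirror-new : ∀ i → i + 4 ≤ p → ∀ j o → o ≤ 3 →
    NewWindowShape (shift j V) o b c → ¬ MirrorWindow V L (suc i) j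
  old-not-mirror-new i i+4≤p j o o≤3 shape mirror =
    old-window-no-long-run i i+4≤p (3 ∸ o) (m∸n≤m 3 o)
      (proj₁ (NewWindowShape-reverse _ (shift j V) o (3 ∸ o) b c (m+[n∸m]≡n o≤3) mirror shape))

  V-no-mirror-window : ∀ i j → i < N → j < N → ¬ MirrorWindow V L i j
  V-no-mirror-window i j i<N j<N mirror with windowKind i i<N | windowKind j j<N
  ... | old {i′} i′+4≤p | old {j′} j′+4≤p =
    proj₂ T-orientable i′ j′ (λ t t<L → trans (sym (V-old-window i′ i′+4≤p t t<L))
      (trans (mirror t t<L) (V-old-window j′ j′+4≤p (5 + k ∸ t) (s≤s (m∸n≤m (5 + k) t)))))
  ... | old {i′} i′+4≤p | new o o≤3 shape _ = old-not-mirror-new i′ i′+4≤p j o o≤3 shape mirror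
  ... | new o o≤3 shape _ | old {j′} j′+4≤p =
    old-not-mirror-new j′ j′+4≤p i o o≤3 shape (MirrorWindow-sym V L i (suc j′) mirror)
  ... | new o o≤3 shape _ | new o′ o′≤3 shape′ _ =
    b≢c (NewWindowShape-b≡c (shift i V) o b c shape
          (subst (λ x → NewWindowShape (shift i V) x c b) (sym o≡3∸o′) reversed))
    where
    reversed : NewWindowShape (shift i V) (3 ∸ o′) c b
    reversed = NewWindowShape-reverse _ (shift j V) o′ (3 ∸ o′) b c (m+[n∸m]≡n o′≤3) mirror shape′
    o≡3∸o′ : o ≡ 3 ∸ o′
    o≡3∸o′ = LongRunAt-offset-unique (shift i V) o (3 ∸ o′) o≤3 (m∸n≤m 3 o′)
               (proj₁ shape) (proj₁ reversed)

  V-orientable : OrientableWindows L N V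
  V-orientable =
    (λ i j same → ModEq-% N (%≡⇒ModEq N (cong (_% N)
       (V-same-window (i % N) (j % N) (m%n<n i N) (m%n<n j N) (SameWindow-% V N L i j V-periodic same))))) ,
    (λ i j mirror → V-no-mirror-window (i % N) (j % N) (m%n<n i N) (m%n<n j N)
         (MirrorWindow-% V N L i j V-periodic mirror))

  T-zero-run : RunAt T (2 + k) false m
  T-zero-run = RunAt-antiperiodic T m (2 + k) true 0 T-antiperiodic T-run

  T-zero-run-unique : ∀ x → x < p → RunAt T (2 + k) false x → x ≡ m
  T-zero-run-unique x x<p run with x <? m
  ... | yes x<m = ⊥-elim (1+n≢0 (m+n≡0⇒n≡0 x (T-run-unique (x + m) x+m<p
                    (RunAt-antiperiodic T m (2 + k) false x T-antiperiodic run))))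
    where
    x+m<p : x + m < p
    x+m<p = subst (x + m <_) (sym p≡m+m) (+-monoˡ-< m x<m)
  ... | no  x≮m with m≤n⇒∃[o]m+o≡n (≮⇒≥ x≮m)
  ... | y , m+y≡x = begin
    x      ≡⟨ m+y≡x ⟨
    m + y  ≡⟨ cong (m +_) (T-run-unique y (<-trans y<m m<p) run-y) ⟩
    m + 0  ≡⟨ +-identityʳ m ⟩
    m      ∎
    where
    y<m : y < m
    y<m = +-cancelˡ-< m y m (subst₂ _<_ (sym m+y≡x) p≡m+m x<p)
    run-y : RunAt T (2 + k) true y
    run-y = RunAt-antiperiodic⁻ T m (2 + k) false y T-antiperiodic (subst (RunAt T (2 + k) false) (sym m+y≡x) run)

  V-zero-run : RunAt V (2 + k) false (suc m)
  V-zero-run t t<2+k = trans (V-suc (m + t) m+t<p) (T-zero-run t t<2+k)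
    where
    m+t<p : m + t < p
    m+t<p = subst (m + t <_) (sym p≡m+m) (+-monoʳ-< m (<-≤-trans t<2+k run-fits))

  V-zero-run-unique : ∀ i → i < N → RunAt V (2 + k) false i → i ≡ suc m
  V-zero-run-unique zero    _ run = ⊥-elim (not-¬ refl (trans (sym V-0) (run 0 z<s)))
  V-zero-run-unique (suc i) (s≤s i<p) run with i + (2 + k) ≤? p
  ... | yes fits = cong suc (T-zero-run-unique i (<-≤-trans (m<m+n i z<s) fits)
                     (λ t t<2+k → trans (sym (V-suc (i + t) (<-≤-trans (+-monoʳ-< i t<2+k) fits))) (run t t<2+k)))
  ... | no  too-late with m≤n⇒∃[o]m+o≡n (<⇒≤ i<p)
  ... | d , i+d≡p = ⊥-elim (not-¬ refl (trans (sym V-wrap) (run d d<2+k)))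
    where
    V-wrap : V (suc i + d) ≡ true
    V-wrap = trans (cong (V ∘ suc) (trans i+d≡p (sym (+-identityʳ p)))) (trans (V-N+ 0) V-0)
    d<2+k : d < 2 + k
    d<2+k = +-cancelˡ-< i d (2 + k) (subst (_< i + (2 + k)) (sym i+d≡p) (≰⇒> too-late))

  V-occursOnce : OccursOnceAt V N (2 + k) false (suc m)
  V-occursOnce = occursOnceAt V N (2 + k) false (suc m) (s≤s m<p) V-zero-run V-zero-run-unique

  V-odd : m % 2 ≡ 0 → parity V N ≡ true
  V-odd m-even = begin
    V 0 xor parity (V ∘ suc) p           ≡⟨ cong₂ _xor_ V-0 (parity-cong p _ _ V-suc) ⟩
    true xor parity T p                  ≡⟨ cong (true xor_) (parity-antiperiodic T m T-antiperiodic) ⟩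
    true xor parity (const true) m       ≡⟨ cong (true xor_) parity-m-false ⟩
    true                                 ∎
    where
    parity-m-false : parity (const true) m ≡ false
    parity-m-false with parity (const true) m | parity-true m
    ... | false | _ = refl
    ... | true  | 1≡m%2 = ⊥-elim (1+n≢0 (trans 1≡m%2 m-even))

-- The extension map

≡ᵇ-reflects-≡ : ∀ m n → Reflects (m ≡ n) (m ≡ᵇ n)
≡ᵇ-reflects-≡ m n = fromEquivalence (≡ᵇ⇒≡ m n) (≡⇒≡ᵇ m n)

extCycle-< : ∀ U r j → j < r → extCycle U r j ≡ U j
extCycle-< U r j j<r with j <ᵇ r | <ᵇ-reflects-< j r
... | true  | _        = refl
... | false | ofⁿ j≮r = ⊥-elim (j≮r j<r)

extCycle-≡ : ∀ U r → extCycle U r r ≡ true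
extCycle-≡ U r with r <ᵇ r | <ᵇ-reflects-< r r | r ≡ᵇ r | ≡ᵇ-reflects-≡ r r
... | true  | ofʸ r<r | _     | _        = ⊥-elim (<-irrefl refl r<r)
... | false | _       | true  | _        = refl
... | false | _       | false | ofⁿ r≢r = ⊥-elim (r≢r refl)

extCycle-> : ∀ U r j → r < j → extCycle U r j ≡ U (j ∸ 1)
extCycle-> U r j r<j with j <ᵇ r | <ᵇ-reflects-< j r | j ≡ᵇ r | ≡ᵇ-reflects-≡ j r
... | true  | ofʸ j<r | _     | _        = ⊥-elim (<-asym r<j j<r)
... | false | _       | true  | ofʸ j≡r  = ⊥-elim (<-irrefl (sym j≡r) r<j)
... | false | _       | false | _        = refl

Ext-odd : ∀ U p r → weight U p % 2 ≡ 1 → Ext U p r ≡ U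
Ext-odd U p r odd rewrite odd = refl

Ext-even : ∀ U p r → weight U p % 2 ≡ 0 → Ext U p r ≡ (λ i → extCycle U r (i % suc p))
Ext-even U p r even rewrite even = refl

module CycleInsertion (U : Seq) (p r : ℕ) (U-periodic : Periodic U p) (r<p : r < p) where

  N : ℕ
  N = suc p

  V : Seq
  V i = extCycle U r (i % N)

  V-periodic : Periodic V N
  V-periodic i = cong (extCycle U r) ([m+n]%n≡m%n i N)

  V-r : V r ≡ true
  V-r = trans (cong (extCycle U r) (m<n⇒m%n≡m (m<n⇒m<1+n r<p))) (extCycle-≡ U r)

  V-r+suc : ∀ y → y < p → V (r + suc y) ≡ U (r + y)
  V-r+suc y y<p with r + suc y <? N
  ... | yes r+y<p = trans (cong (extCycle U r) (m<n⇒m%n≡m r+y<p))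
                      (trans (extCycle-> U r (r + suc y) (m<m+n r z<s)) (cong U (cong pred (+-suc r y))))
  ... | no  r+y≮p with m≤n⇒∃[o]m+o≡n (≮⇒≥ r+y≮p)
  ... | w , N+w≡r+y+1 = begin
    extCycle U r ((r + suc y) % N)  ≡⟨ cong (extCycle U r) wrapped ⟩
    extCycle U r w                  ≡⟨ extCycle-< U r w w<r ⟩
    U w                             ≡⟨ U-periodic w ⟨
    U (w + p)                       ≡⟨ cong U (sym r+y≡w+p) ⟩
    U (r + y)                       ∎
    where
    w<N : w < N
    w<N = +-cancelˡ-< N w N (subst (_< N + N) (sym N+w≡r+y+1) (+-mono-< (m<n⇒m<1+n r<p) (s≤s y<p)))
    wrapped : (r + suc y) % N ≡ w
    wrapped = trans (cong (_% N) (trans (sym N+w≡r+y+1) (+-comm N w))) (trans ([m+n]%n≡m%n w N) (m<n⇒m%n≡m w<N))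
    w<r : w < r
    w<r = +-cancelʳ-< N w r (subst (_< r + N) (sym (trans (+-comm w N) N+w≡r+y+1)) (+-monoʳ-< r (s≤s y<p)))
    r+y≡w+p : r + y ≡ w + p
    r+y≡w+p = suc-injective (trans (sym (+-suc r y)) (trans (sym N+w≡r+y+1) (cong suc (+-comm p w))))

module LempelExtension (k m₁ r₀ : ℕ) (S T : Seq)
  (S-periodic : Periodic S (suc m₁))
  (S-orientable : OrientableWindows (5 + k) (suc m₁) S)
  (S-zero-run : OccursOnceAt S (suc m₁) (1 + k) false r₀)
  (S-odd : weight S (suc m₁) % 2 ≡ 1)
  (derivative : ∀ i → (T i xor T (suc i)) ≡ S i) where

  open Lempel m₁ S T S-periodic (odd-weight⇒parity S (suc m₁) S-odd) derivative
  open Runs (1 + k) r₀ S-zero-run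

  r : ℕ
  r = proj₁ (T-occursOnce true)

  T-ones : OccursOnceAt T p (2 + k) true r
  T-ones = proj₂ (T-occursOnce true)

  T-isPeriod : IsPeriod T p
  T-isPeriod = OccursOnceAt⇒IsPeriod T (pred p) (2 + k) true r T-periodic T-ones

  T-orientable : OrientableWindows (6 + k) p T
  T-orientable = T-orientableWindows (5 + k) S-orientable

  T-good : Good (6 + k) p T
  T-good = OrientableWindows⇒Orientable (6 + k) p T T-isPeriod T-orientable , T-occursOnce false

  odd-case : m % 2 ≡ 1 → Good (6 + k) p (Ext T p r) × weight (Ext T p r) p % 2 ≡ 1
  odd-case m-odd = subst (λ U → Good (6 + k) p U × weight U p % 2 ≡ 1)
                         (sym (Ext-odd T p r T-odd)) (T-good , T-odd)
    where
    T-odd : weight T p % 2 ≡ 1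
    T-odd = trans weight-T m-odd

  module Inserted = CycleInsertion T p r T-periodic (proj₁ T-ones)
  open Inserted using (V; N; V-periodic)

  -- Rotating both cycles to the start of the run of ones brings us to the setting of LengthenedRun.
  module Rotated = LengthenedRun k m₁ (shift r T) (shift r V)
    (shift-periodic T p r T-periodic)
    (shift-antiperiodic T m r T-antiperiodic)
    (window-replicate⇒RunAt T (2 + k) true r (proj₁ (proj₂ T-ones)))
    (OccursOnceAt-shift-unique T (pred p) (2 + k) true r T-periodic T-ones)
    (OrientableWindows-shift (6 + k) p T r T-orientable)
    (trans (cong V (+-identityʳ r)) Inserted.V-r)
    Inserted.V-r+suc
    (shift-periodic V N r V-periodic)

  V-zeros : OccursOnceAt V N (2 + k) false ((r + suc m) % N)
  V-zeros = OccursOnceAt-unshift V p r (2 + k) false (suc m) V-periodic Rotated.V-occursOnce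

  V-good : Good (6 + k) N V
  V-good = OrientableWindows⇒Orientable (6 + k) N V
             (OccursOnceAt⇒IsPeriod V p (2 + k) false _ V-periodic V-zeros)
             (OrientableWindows-unshift (6 + k) p V r V-periodic Rotated.V-orientable) ,
           (_ , V-zeros)

  V-odd : m % 2 ≡ 0 → weight V N % 2 ≡ 1
  V-odd m-even = parity⇒odd-weight V N
    (trans (sym (parity-rotate V N V-periodic r)) (Rotated.V-odd m-even))

  even-case : m % 2 ≡ 0 → Good (6 + k) N (Ext T p r) × weight (Ext T p r) N % 2 ≡ 1
  even-case m-even = subst (λ U → Good (6 + k) N U × weight U N % 2 ≡ 1)
                           (sym (Ext-even T p r (trans weight-T m-even))) (V-good , V-odd m-even)

theorem5 : (n m : ℕ) (S T : Seq) →
    Good n m S → weight S m % 2 ≡ 1 → InvLempel S T →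
    ∃[ p ] ∃[ r ] (IsPeriod T p × OccursOnceAt T p (suc n ∸ 4) true r
      × (m % 2 ≡ 1 → Good (suc n) (2 * m) (Ext T p r)
                      × weight (Ext T p r) (2 * m) % 2 ≡ 1)
      × (m % 2 ≡ 0 → Good (suc n) (suc (2 * m)) (Ext T p r)
                      × weight (Ext T p r) (suc (2 * m)) % 2 ≡ 1))
theorem5 0 m S T (orientable , empty) _ _ = ⊥-elim (Orientable⇒¬OccursOnce-empty 0 m S orientable empty)
theorem5 1 m S T (orientable , empty) _ _ = ⊥-elim (Orientable⇒¬OccursOnce-empty 1 m S orientable empty)
theorem5 2 m S T (orientable , empty) _ _ = ⊥-elim (Orientable⇒¬OccursOnce-empty 2 m S orientable empty)
theorem5 3 m S T (orientable , empty) _ _ = ⊥-elim (Orientable⇒¬OccursOnce-empty 3 m S orientable empty)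
theorem5 4 m S T (orientable , empty) _ _ = ⊥-elim (Orientable⇒¬OccursOnce-empty 4 m S orientable empty)
theorem5 (suc (suc (suc (suc (suc k))))) zero S T ((((() , _) , _) , _) , _) _ _
theorem5 (suc (suc (suc (suc (suc k))))) (suc m₁) S T
         (orientable@(((_ , S-periodic) , _) , _) , r₀ , S-zero-run) S-odd (_ , derivative) =
  2 * suc m₁ , r , T-isPeriod , T-ones , odd-case , even-case
  where
  open LempelExtension k m₁ r₀ S T S-periodic (Orientable⇒OrientableWindows _ _ S orientable)
                       S-zero-run S-odd derivative
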